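{- Let $(\Sigma,E)$ be an order-sorted equational theory (with $E$ a set of possibly conditional $\Sigma$-equations), and let $(\Sigma^{=},E)$ be its extension in which the signature $\Sigma$ is enlarged to $\Sigma^{=}$ so that quantifier-free $\Sigma$-formulas are represented as terms of a new Boolean sort. Let $\varphi$ and $\psi$ be quantifier-free $\Sigma$-formulas such that $\varphi =_{E} \psi$ (i.e., $\varphi$ and $\psi$, viewed as $\Sigma^{=}$-terms, are provably equal using the equations $E$). Then for every $(\Sigma,E)$-algebra $A$ and every assignment $a \in [X \to A]$, where $X$ is a set of variables containing the variables of $\varphi$ and $\psi$, \[ A, a \models \varphi \iff A, a \models \psi . \] That is, $E \models \varphi \Leftrightarrow \psi$.
   Context: Order-sorted signatures $\Sigma$ have a poset of sorts; all atomic formulas are $\Sigma$-equations $t=t'$ with $t,t'$ in the same connected component of sorts. Quantifier-free $\Sigma$-formulas are built from such equations with $\wedge,\vee,\neg$ (and constants $\top,\bot$). The signature $\Sigma^{=}$ extends $\Sigma$ with a fresh sort $\mathit{NewBool}$, constants $\top,\bot$, Boolean operators $\wedge,\vee,\neg$ on $\mathit{NewBool}$, and, for each connected component of sorts of $\Sigma$, a binary operator $\_=\_$ into $\mathit{NewBool}$; thus each quantifier-free $\Sigma$-formula is a $\Sigma^{=}$-term of sort $\mathit{NewBool}$ (no equations defining these new operators are added here). $\varphi =_E \psi$ means that $E \vdash \varphi = \psi$ in order-sorted equational logic over $\Sigma^{=}$. A $(\Sigma,E)$-algebra is an order-sorted $\Sigma$-algebra satisfying all equations in $E$, and $A,a\models\varphi$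 is the usual Tarskian satisfaction of a quantifier-free formula under the assignment $a$. -}

module Defs where

open import Level using (Level; _⊔_; suc; 0ℓ)
open import Data.Maybe using (Maybe; just; nothing)
open import Data.List using (List; []; _∷_; map)
open import Data.List.Relation.Binary.Pointwise using (Pointwise; []; _∷_)
open import Data.List.Relation.Unary.All using (All)
open import Data.Product using (Σ; _,_; proj₁; proj₂; _×_)
open import Data.Sum using (_⊎_)
open import Data.Unit.Polymorphic using (⊤)
open import Data.Empty.Polymorphic using (⊥)
open import Relation.Nullary using (¬_)
open import Relation.Binary.PropositionalEquality using (_≡_; refl; cong; isEquivalence)
open import Relation.Binary.Structures using (IsPartialOrder; IsPreorder)
open import Relation.Binary.Construct.Closure.Equivalence using (EqClosure; gmap)
open import Relation.Binary.Construct.Closure.Symmetric using (SymClosure; fwd; bwd)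

record Signature : Set₁ where
  field
    Sort  : Set
    _≤_   : Sort → Sort → Set
    ≤-po  : IsPartialOrder _≡_ _≤_
    Op    : Set
    Rank  : Op → List Sort → Sort → Set

  -- "s and s' lie in the same connected component of (Sort, ≤)"
  _~_ : Sort → Sort → Set
  _~_ = EqClosure _≤_

open Signature public

record Vars (S : Signature) : Set₁ where
  field
    V    : Set
    sort : V → Sort S
open Vars public

data Term (S : Signature) (V : Set) : Set where
  var : V → Term S V
  app : Op S → List (Term S V) → Term S V

data HasSort (S : Signature) (X : Vars S) : Term S (V X) → Sort S → Set where
  var : ∀ {x s} → _≤_ S (sort X x) s → HasSort S X (var x) s
  app : ∀ {f ts w s' s} → Rank S f w s' → Pointwise (HasSort S X) ts w →
        _≤_ S s' s → HasSort S X (app f ts) s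

mutual
  subst : ∀ {S V W} → (V → Term S W) → Term S V → Term S W
  subst σ (var x) = σ x
  subst σ (app f ts) = app f (substs σ ts)

  substs : ∀ {S V W} → (V → Term S W) → List (Term S V) → List (Term S W)
  substs σ [] = []
  substs σ (t ∷ ts) = subst σ t ∷ substs σ ts

-- Carriers A_s are subsets of an ambient set U,
-- A_s ⊆ A_s' for s ≤ s', each rank f : w → s is interpreted as a function
-- A_w → A_s, and interpretations of the same symbol agree on common arguments.

record Algebra (S : Signature) (a m : Level) : Set (suc (a ⊔ m)) where
  field
    U         : Set a
    _∈_       : U → Sort S → Set m
    mono      : ∀ {s s' u} → _≤_ S s s' → u ∈ s → u ∈ s'
    op        : ∀ {f w s} → Rank S f w s → (us : List U) → Pointwise _∈_ us w → U
    op-closed : ∀ {f w s} (r : Rank S f w s) us (p : Pointwise _∈_ us w) → op r us p ∈ s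
    op-agree  : ∀ {f w s w' s'} (r : Rank S f w s) (r' : Rank S f w' s') us
                (p : Pointwise _∈_ us w) (p' : Pointwise _∈_ us w') →
                op r us p ≡ op r' us p'
open Algebra public

Assignment : ∀ {S a m} → Algebra S a m → Vars S → Set (a ⊔ m)
Assignment A X = Σ (V X → U A) λ a → ∀ x → _∈_ A (a x) (sort X x)

module _ {S : Signature} {a m} (A : Algebra S a m) {X : Vars S} (ρ : Assignment A X) where
  mutual
    evalD : ∀ {t s} → HasSort S X t s → Σ (U A) λ u → _∈_ A u s
    evalD (var {x} le) = proj₁ ρ x , mono A le (proj₂ ρ x)
    evalD (app r ds le) =
      op A r (proj₁ (evalDs ds)) (proj₂ (evalDs ds)) ,
      mono A le (op-closed A r (proj₁ (evalDs ds)) (proj₂ (evalDs ds)))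

    evalDs : ∀ {ts w} → Pointwise (HasSort S X) ts w →
             Σ (List (U A)) λ us → Pointwise (_∈_ A) us w
    evalDs [] = [] , []
    evalDs (d ∷ ds) = proj₁ (evalD d) ∷ proj₁ (evalDs ds) , proj₂ (evalD d) ∷ proj₂ (evalDs ds)

  ⟦_⟧ : ∀ {t s} → HasSort S X t s → U A
  ⟦ d ⟧ = proj₁ (evalD d)

record AtomicEq (S : Signature) (X : Vars S) : Set where
  constructor mkEq
  field
    {lhs rhs}     : Term S (V X)
    {lsort rsort} : Sort S
    ld   : HasSort S X lhs lsort
    rd   : HasSort S X rhs rsort
    comp : _~_ S lsort rsort
open AtomicEq public

record Equation (S : Signature) : Set₁ where
  field
    vars  : Vars S
    concl : AtomicEq S vars
    conds : List (AtomicEq S vars)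
open Equation public

HoldsAt : ∀ {S a m} (A : Algebra S a m) {X : Vars S} → Assignment A X → AtomicEq S X → Set a
HoldsAt A ρ e = ⟦_⟧ A ρ (ld e) ≡ ⟦_⟧ A ρ (rd e)

Satisfies : ∀ {S a m} → Algebra S a m → Equation S → Set (a ⊔ m)
Satisfies A e = (ρ : Assignment A (vars e)) → All (HoldsAt A ρ) (conds e) → HoldsAt A ρ (concl e)

IsModel : ∀ {S a m} → Algebra S a m → {I : Set} → (I → Equation S) → Set (a ⊔ m)
IsModel A {I} E = (i : I) → Satisfies A (E i)

data Provable (S : Signature) {I : Set} (E : I → Equation S) (X : Vars S) :
     Term S (V X) → Term S (V X) → Set where
  ⊢refl : ∀ {t s} → HasSort S X t s → Provable S E X t t
  sym   : ∀ {t t'} → Provable S E X t t' → Provable S E X t' t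
  ⊢trans : ∀ {t t' t''} → Provable S E X t t' → Provable S E X t' t'' → Provable S E X t t''
  ⊢cong : ∀ {f ts ts' s s'} → Pointwise (Provable S E X) ts ts' →
          HasSort S X (app f ts) s → HasSort S X (app f ts') s' →
          Provable S E X (app f ts) (app f ts')
  ⊢repl : (i : I) (σ : V (vars (E i)) → Term S (V X)) →
          (∀ x → HasSort S X (σ x) (sort (vars (E i)) x)) →
          All (λ c → Provable S E X (subst σ (lhs c)) (subst σ (rhs c))) (conds (E i)) →
          Provable S E X (subst σ (lhs (concl (E i)))) (subst σ (rhs (concl (E i))))

data Formula (S : Signature) (X : Vars S) : Set where
  atom    : AtomicEq S X → Formula S X
  ⊤f ⊥f   : Formula S X
  _∧f_ _∨f_ : Formula S X → Formula S X → Formula S X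
  ¬f_     : Formula S X → Formula S X

Sat : ∀ {S a m} (A : Algebra S a m) {X : Vars S} → Assignment A X → Formula S X → Set a
Sat A ρ (atom e) = HoldsAt A ρ e
Sat A ρ ⊤f = ⊤
Sat A ρ ⊥f = ⊥
Sat A ρ (φ ∧f ψ) = Sat A ρ φ × Sat A ρ ψ
Sat A ρ (φ ∨f ψ) = Sat A ρ φ ⊎ Sat A ρ ψ
Sat A ρ (¬f φ) = ¬ Sat A ρ φ

-- The extension Σ⁼: new sort NewBool (= nothing), constants ⊤ ⊥,
-- ∧ ∨ ¬ on NewBool, and an equality operator _=_ : s s' → NewBool for
-- each pair of sorts s ~ s' of one connected component (all these ranks
-- belong to one overloaded symbol per component; a single symbol `eqOp`
-- overloaded over all components is used, which is equivalent since
-- ranks in different components are unrelated).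

module _ (S : Signature) where

  data _≤⁼_ : Maybe (Sort S) → Maybe (Sort S) → Set where
    just≤ : ∀ {s s'} → _≤_ S s s' → just s ≤⁼ just s'
    nb≤   : nothing ≤⁼ nothing

  data Op⁼ : Set where
    old   : Op S → Op⁼
    trueOp falseOp andOp orOp notOp eqOp : Op⁼

  data Rank⁼ : Op⁼ → List (Maybe (Sort S)) → Maybe (Sort S) → Set where
    old   : ∀ {f w s} → Rank S f w s → Rank⁼ (old f) (map just w) (just s)
    true  : Rank⁼ trueOp [] nothing
    false : Rank⁼ falseOp [] nothing
    and   : Rank⁼ andOp (nothing ∷ nothing ∷ []) nothing
    or    : Rank⁼ orOp (nothing ∷ nothing ∷ []) nothing
    not   : Rank⁼ notOp (nothing ∷ []) nothing
    eq    : ∀ {s s'} → _~_ S s s' → Rank⁼ eqOp (just s ∷ just s' ∷ []) nothing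

  private
    module P = IsPartialOrder (≤-po S)

    ≤⁼-refl : ∀ {x y} → x ≡ y → x ≤⁼ y
    ≤⁼-refl {just s} refl = just≤ (P.reflexive refl)
    ≤⁼-refl {nothing} refl = nb≤

    ≤⁼-trans : ∀ {x y z} → x ≤⁼ y → y ≤⁼ z → x ≤⁼ z
    ≤⁼-trans (just≤ p) (just≤ q) = just≤ (P.trans p q)
    ≤⁼-trans nb≤ nb≤ = nb≤

    ≤⁼-antisym : ∀ {x y} → x ≤⁼ y → y ≤⁼ x → x ≡ y
    ≤⁼-antisym (just≤ p) (just≤ q) = cong just (P.antisym p q)
    ≤⁼-antisym nb≤ nb≤ = refl

  Sig⁼ : Signature
  Sig⁼ = record
    { Sort = Maybe (Sort S)
    ; _≤_  = _≤⁼_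
    ; ≤-po = record
        { isPreorder = record
            { isEquivalence = isEquivalence
            ; reflexive = ≤⁼-refl
            ; trans = ≤⁼-trans }
        ; antisym = ≤⁼-antisym }
    ; Op   = Op⁼
    ; Rank = Rank⁼
    }

module _ {S : Signature} where

  liftVars : Vars S → Vars (Sig⁼ S)
  liftVars X = record { V = V X ; sort = λ x → just (sort X x) }

  mutual
    liftT : ∀ {W} → Term S W → Term (Sig⁼ S) W
    liftT (var x) = var x
    liftT (app f ts) = app (old f) (liftTs ts)

    liftTs : ∀ {W} → List (Term S W) → List (Term (Sig⁼ S) W)
    liftTs [] = []
    liftTs (t ∷ ts) = liftT t ∷ liftTs ts

  mutual
    liftD : ∀ {X t s} → HasSort S X t s → HasSort (Sig⁼ S) (liftVars X) (liftT t) (just s)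
    liftD (var le) = var (just≤ le)
    liftD (app r ds le) = app (old r) (liftDs ds) (just≤ le)

    liftDs : ∀ {X ts w} → Pointwise (HasSort S X) ts w →
             Pointwise (HasSort (Sig⁼ S) (liftVars X)) (liftTs ts) (map just w)
    liftDs [] = []
    liftDs (d ∷ ds) = liftD d ∷ liftDs ds

  liftComp : ∀ {s s'} → _~_ S s s' → _~_ (Sig⁼ S) (just s) (just s')
  liftComp = gmap just (just≤ {S = S})

  liftAtom : ∀ {X} → AtomicEq S X → AtomicEq (Sig⁼ S) (liftVars X)
  liftAtom e = mkEq (liftD (ld e)) (liftD (rd e)) (liftComp (comp e))

  liftEq : Equation S → Equation (Sig⁼ S)
  liftEq e = record
    { vars  = liftVars (vars e)
    ; concl = liftAtom (concl e)
    ; conds = map liftAtom (conds e) }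

  ⌜_⌝ : ∀ {X} → Formula S X → Term (Sig⁼ S) (V X)
  ⌜ atom e ⌝ = app eqOp (liftT (lhs e) ∷ liftT (rhs e) ∷ [])
  ⌜ ⊤f ⌝ = app trueOp []
  ⌜ ⊥f ⌝ = app falseOp []
  ⌜ φ ∧f ψ ⌝ = app andOp (⌜ φ ⌝ ∷ ⌜ ψ ⌝ ∷ [])
  ⌜ φ ∨f ψ ⌝ = app orOp (⌜ φ ⌝ ∷ ⌜ ψ ⌝ ∷ [])
  ⌜ ¬f φ ⌝ = app notOp (⌜ φ ⌝ ∷ [])

{-# OPTIONS --safe #-}
module Submission where

-- Order-sorted equational deduction is sound, so it suffices to find, for every
-- (Σ,E)-algebra A, a Σ⁼-algebra satisfying the lifted equations E in which the
-- term ⌜ φ ⌝ denotes the truth of φ in A.  Expand A by interpreting NewBool as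
-- the universe of propositions Set a, the equality symbol as ≡ and the
-- connectives as ×, ⊎ and ¬.  The lifted equations only mention old symbols,
-- so the expansion still satisfies them; and ⌜ φ ⌝ evaluates to Sat A ρ φ.
-- Soundness then makes Sat A ρ φ and Sat A ρ ψ equal types, hence equivalent.

open import Defs
open import Level using (Level) renaming (suc to lsuc)
open import Data.List using (List; []; _∷_; map)
open import Data.List.Relation.Binary.Pointwise using (Pointwise; []; _∷_)
open import Data.List.Relation.Unary.All using (All; []; _∷_)
open import Data.Maybe using (Maybe; just; nothing)
open import Data.Product using (∃; _,_; proj₁; proj₂; _×_)
open import Data.Sum using (_⊎_; inj₁; inj₂)
open import Data.Sum.Properties using (inj₁-injective; inj₂-injective)
open import Data.Unit.Polymorphic using (⊤; tt)
open import Data.Empty.Polymorphic using (⊥)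
open import Function.Base using (_∘_)
open import Function.Bundles using (_⇔_)
open import Function.Related.Propositional using (≡⇒; equivalence)
open import Relation.Nullary using (¬_)
open import Relation.Binary.Structures using (IsPartialOrder)
open import Relation.Binary.PropositionalEquality as ≡
  using (_≡_; refl; cong; cong₂; trans; module ≡-Reasoning)

module _ {S : Signature} where

  HasSort-mono : ∀ {X t s s'} → HasSort S X t s → _≤_ S s s' → HasSort S X t s'
  HasSort-mono (var le) le' = var (IsPartialOrder.trans (≤-po S) le le')
  HasSort-mono (app r ds le) le' = app r ds (IsPartialOrder.trans (≤-po S) le le')

  module _ {X Y : Vars S} {σ : V Y → Term S (V X)}
           (σ-sorted : ∀ y → HasSort S X (σ y) (sort Y y)) where
    mutual
      subst-HasSort : ∀ {t s} → HasSort S Y t s → HasSort S X (subst σ t) s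
      subst-HasSort (var {y} le) = HasSort-mono (σ-sorted y) le
      subst-HasSort (app r ds le) = app r (substs-HasSort ds) le

      substs-HasSort : ∀ {ts w} → Pointwise (HasSort S Y) ts w →
                       Pointwise (HasSort S X) (substs σ ts) w
      substs-HasSort [] = []
      substs-HasSort (d ∷ ds) = subst-HasSort d ∷ substs-HasSort ds

module _ {S : Signature} {a m} (A : Algebra S a m) where

  op-cong : ∀ {f w s w' s'} (r : Rank S f w s) (r' : Rank S f w' s') {us us'}
            (p : Pointwise (_∈_ A) us w) (p' : Pointwise (_∈_ A) us' w') →
            us ≡ us' → op A r us p ≡ op A r' us' p'
  op-cong r r' p p' refl = op-agree A r r' _ p p'

  module _ {X : Vars S} (ρ : Assignment A X) where
    mutual
      ⟦⟧-irrelevant : ∀ {t s s'} (d : HasSort S X t s) (d' : HasSort S X t s') →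
                      ⟦_⟧ A ρ d ≡ ⟦_⟧ A ρ d'
      ⟦⟧-irrelevant (var _) (var _) = refl
      ⟦⟧-irrelevant (app r ds _) (app r' ds' _) = op-cong r r' _ _ (⟦⟧s-irrelevant ds ds')

      ⟦⟧s-irrelevant : ∀ {ts w w'} (ds : Pointwise (HasSort S X) ts w)
                       (ds' : Pointwise (HasSort S X) ts w') →
                       proj₁ (evalDs A ρ ds) ≡ proj₁ (evalDs A ρ ds')
      ⟦⟧s-irrelevant [] [] = refl
      ⟦⟧s-irrelevant (d ∷ ds) (d' ∷ ds') =
        cong₂ _∷_ (⟦⟧-irrelevant d d') (⟦⟧s-irrelevant ds ds')

  module _ {X Y : Vars S} {σ : V Y → Term S (V X)}
           (σ-sorted : ∀ y → HasSort S X (σ y) (sort Y y)) (ρ : Assignment A X) where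

    substAssignment : Assignment A Y
    substAssignment = (λ y → ⟦_⟧ A ρ (σ-sorted y)) , (λ y → proj₂ (evalD A ρ (σ-sorted y)))

    mutual
      ⟦⟧-subst : ∀ {t s s'} (d : HasSort S Y t s) (d' : HasSort S X (subst σ t) s') →
                 ⟦_⟧ A ρ d' ≡ ⟦_⟧ A substAssignment d
      ⟦⟧-subst (var {y} _) d' = ⟦⟧-irrelevant ρ d' (σ-sorted y)
      ⟦⟧-subst (app r ds _) (app r' ds' _) = op-cong r' r _ _ (⟦⟧s-subst ds ds')

      ⟦⟧s-subst : ∀ {ts w w'} (ds : Pointwise (HasSort S Y) ts w)
                  (ds' : Pointwise (HasSort S X) (substs σ ts) w') →
                  proj₁ (evalDs A ρ ds') ≡ proj₁ (evalDs A substAssignment ds)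
      ⟦⟧s-subst [] [] = refl
      ⟦⟧s-subst (d ∷ ds) (d' ∷ ds') = cong₂ _∷_ (⟦⟧-subst d d') (⟦⟧s-subst ds ds')

module _ {S : Signature} {I : Set} {E : I → Equation S} {X : Vars S} where

  Sorted : Term S (V X) → Set
  Sorted t = ∃ (HasSort S X t)

  Provable-sorted : ∀ {t t'} → Provable S E X t t' → Sorted t × Sorted t'
  Provable-sorted (⊢refl d) = (_ , d) , (_ , d)
  Provable-sorted (sym p) = proj₂ (Provable-sorted p) , proj₁ (Provable-sorted p)
  Provable-sorted (⊢trans p q) = proj₁ (Provable-sorted p) , proj₂ (Provable-sorted q)
  Provable-sorted (⊢cong _ d d') = (_ , d) , (_ , d')
  Provable-sorted (⊢repl i σ σ-sorted _) =
    (_ , subst-HasSort σ-sorted (ld (concl (E i)))) , (_ , subst-HasSort σ-sorted (rd (concl (E i))))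

  module _ {a m} {A : Algebra S a m} (model : IsModel A E) (ρ : Assignment A X) where
    mutual
      sound : ∀ {t t' s s'} → Provable S E X t t' →
              (d : HasSort S X t s) (d' : HasSort S X t' s') → ⟦_⟧ A ρ d ≡ ⟦_⟧ A ρ d'
      sound (⊢refl _) d d' = ⟦⟧-irrelevant A ρ d d'
      sound (sym p) d d' = ≡.sym (sound p d' d)
      sound (⊢trans p q) d d' = trans (sound p d dₘ) (sound q dₘ d')
        where dₘ = proj₂ (proj₂ (Provable-sorted p))
      sound (⊢cong ps _ _) (app r ds _) (app r' ds' _) = op-cong A r r' _ _ (sounds ps ds ds')
      sound (⊢repl i σ σ-sorted cs) d d' = begin
        ⟦_⟧ A ρ d                                   ≡⟨ ⟦⟧-subst A σ-sorted ρ (ld c) d ⟩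
        ⟦_⟧ A (substAssignment A σ-sorted ρ) (ld c) ≡⟨ model i _ (sound-conds σ-sorted cs) ⟩
        ⟦_⟧ A (substAssignment A σ-sorted ρ) (rd c) ≡⟨ ⟦⟧-subst A σ-sorted ρ (rd c) d' ⟨
        ⟦_⟧ A ρ d'                                  ∎
        where open ≡-Reasoning
              c = concl (E i)

      sounds : ∀ {ts ts' w w'} → Pointwise (Provable S E X) ts ts' →
               (ds : Pointwise (HasSort S X) ts w) (ds' : Pointwise (HasSort S X) ts' w') →
               proj₁ (evalDs A ρ ds) ≡ proj₁ (evalDs A ρ ds')
      sounds [] [] [] = refl
      sounds (p ∷ ps) (d ∷ ds) (d' ∷ ds') = cong₂ _∷_ (sound p d d') (sounds ps ds ds')

      sound-conds : ∀ {Y : Vars S} {σ : V Y → Term S (V X)}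
                    (σ-sorted : ∀ y → HasSort S X (σ y) (sort Y y)) {cs : List (AtomicEq S Y)} →
                    All (λ c → Provable S E X (subst σ (lhs c)) (subst σ (rhs c))) cs →
                    All (HoldsAt A (substAssignment A σ-sorted ρ)) cs
      sound-conds σ-sorted [] = []
      sound-conds σ-sorted {c ∷ _} (p ∷ ps) =
        trans (≡.sym (⟦⟧-subst A σ-sorted ρ (ld c) dˡ))
              (trans (sound p dˡ dʳ) (⟦⟧-subst A σ-sorted ρ (rd c) dʳ))
        ∷ sound-conds σ-sorted ps
        where dˡ = subst-HasSort σ-sorted (ld c)
              dʳ = subst-HasSort σ-sorted (rd c)

module _ {S : Signature} {X : Vars S} where

  ⌜⌝-sorted : (φ : Formula S X) → HasSort (Sig⁼ S) (liftVars X) ⌜ φ ⌝ nothing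
  ⌜⌝-sorted (atom e) = app (eq (comp e)) (liftD (ld e) ∷ liftD (rd e) ∷ []) nb≤
  ⌜⌝-sorted ⊤f = app true [] nb≤
  ⌜⌝-sorted ⊥f = app false [] nb≤
  ⌜⌝-sorted (φ ∧f ψ) = app and (⌜⌝-sorted φ ∷ ⌜⌝-sorted ψ ∷ []) nb≤
  ⌜⌝-sorted (φ ∨f ψ) = app or (⌜⌝-sorted φ ∷ ⌜⌝-sorted ψ ∷ []) nb≤
  ⌜⌝-sorted (¬f φ) = app not (⌜⌝-sorted φ ∷ []) nb≤

module PropositionalExpansion {S : Signature} {a m} (A : Algebra S a m) where

  U⁼ : Set (lsuc a)
  U⁼ = U A ⊎ Set a

  _∈⁼_ : U⁼ → Maybe (Sort S) → Set m
  inj₁ u ∈⁼ just s  = _∈_ A u s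
  inj₁ u ∈⁼ nothing = ⊥
  inj₂ P ∈⁼ just s  = ⊥
  inj₂ P ∈⁼ nothing = ⊤

  element : (x : U⁼) {s : Sort S} → x ∈⁼ just s → U A
  element (inj₁ u) _ = u

  element-∈ : (x : U⁼) {s : Sort S} (p : x ∈⁼ just s) → _∈_ A (element x p) s
  element-∈ (inj₁ u) p = p

  element-irrelevant : (x : U⁼) {s s' : Sort S} (p : x ∈⁼ just s) (p' : x ∈⁼ just s') →
                       element x p ≡ element x p'
  element-irrelevant (inj₁ u) _ _ = refl

  element-inj₁ : (x : U⁼) {s : Sort S} (p : x ∈⁼ just s) {u : U A} →
                 x ≡ inj₁ u → element x p ≡ u
  element-inj₁ (inj₁ u) p refl = refl

  inj₁-element : (x : U⁼) {s : Sort S} (p : x ∈⁼ just s) → x ≡ inj₁ (element x p)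
  inj₁-element (inj₁ u) p = refl

  proposition : (x : U⁼) → x ∈⁼ nothing → Set a
  proposition (inj₂ P) _ = P

  proposition-irrelevant : (x : U⁼) (p p' : x ∈⁼ nothing) → proposition x p ≡ proposition x p'
  proposition-irrelevant (inj₂ P) _ _ = refl

  proposition-inj₂ : (x : U⁼) (p : x ∈⁼ nothing) {P : Set a} →
                     x ≡ inj₂ P → proposition x p ≡ P
  proposition-inj₂ (inj₂ P) p refl = refl

  elements : ∀ {w} (xs : List U⁼) → Pointwise _∈⁼_ xs (map just w) → List (U A)
  elements {[]} [] [] = []
  elements {s ∷ w} (x ∷ xs) (p ∷ ps) = element x p ∷ elements xs ps

  elements-∈ : ∀ {w} (xs : List U⁼) (ps : Pointwise _∈⁼_ xs (map just w)) →
               Pointwise (_∈_ A) (elements xs ps) w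
  elements-∈ {[]} [] [] = []
  elements-∈ {s ∷ w} (x ∷ xs) (p ∷ ps) = element-∈ x p ∷ elements-∈ xs ps

  elements-irrelevant : ∀ {w w'} (xs : List U⁼) (ps : Pointwise _∈⁼_ xs (map just w))
                        (ps' : Pointwise _∈⁼_ xs (map just w')) →
                        elements xs ps ≡ elements xs ps'
  elements-irrelevant {[]} {[]} [] [] [] = refl
  elements-irrelevant {s ∷ w} {s' ∷ w'} (x ∷ xs) (p ∷ ps) (p' ∷ ps') =
    cong₂ _∷_ (element-irrelevant x p p') (elements-irrelevant xs ps ps')

  op⁼ : ∀ {f w s} → Rank⁼ S f w s → (xs : List U⁼) → Pointwise _∈⁼_ xs w → U⁼
  op⁼ (old r) xs ps = inj₁ (op A r (elements xs ps) (elements-∈ xs ps))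
  op⁼ true _ _ = inj₂ ⊤
  op⁼ false _ _ = inj₂ ⊥
  op⁼ and (x ∷ y ∷ []) (p ∷ q ∷ []) = inj₂ (proposition x p × proposition y q)
  op⁼ or (x ∷ y ∷ []) (p ∷ q ∷ []) = inj₂ (proposition x p ⊎ proposition y q)
  op⁼ not (x ∷ []) (p ∷ []) = inj₂ (¬ proposition x p)
  op⁼ (eq _) (x ∷ y ∷ []) (p ∷ q ∷ []) = inj₂ (element x p ≡ element y q)

  op⁼-closed : ∀ {f w s} (r : Rank⁼ S f w s) xs (ps : Pointwise _∈⁼_ xs w) →
               op⁼ r xs ps ∈⁼ s
  op⁼-closed (old r) xs ps = op-closed A r _ _
  op⁼-closed true _ _ = tt
  op⁼-closed false _ _ = tt
  op⁼-closed and (_ ∷ _ ∷ []) (_ ∷ _ ∷ []) = tt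
  op⁼-closed or (_ ∷ _ ∷ []) (_ ∷ _ ∷ []) = tt
  op⁼-closed not (_ ∷ []) (_ ∷ []) = tt
  op⁼-closed (eq _) (_ ∷ _ ∷ []) (_ ∷ _ ∷ []) = tt

  op⁼-agree : ∀ {f w s w' s'} (r : Rank⁼ S f w s) (r' : Rank⁼ S f w' s') xs
              (ps : Pointwise _∈⁼_ xs w) (ps' : Pointwise _∈⁼_ xs w') →
              op⁼ r xs ps ≡ op⁼ r' xs ps'
  op⁼-agree (old r) (old r') xs ps ps' =
    cong inj₁ (op-cong A r r' _ _ (elements-irrelevant xs ps ps'))
  op⁼-agree true true _ _ _ = refl
  op⁼-agree false false _ _ _ = refl
  op⁼-agree and and (x ∷ y ∷ []) (p ∷ q ∷ []) (p' ∷ q' ∷ []) =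
    cong₂ (λ P Q → inj₂ (P × Q)) (proposition-irrelevant x p p') (proposition-irrelevant y q q')
  op⁼-agree or or (x ∷ y ∷ []) (p ∷ q ∷ []) (p' ∷ q' ∷ []) =
    cong₂ (λ P Q → inj₂ (P ⊎ Q)) (proposition-irrelevant x p p') (proposition-irrelevant y q q')
  op⁼-agree not not (x ∷ []) (p ∷ []) (p' ∷ []) =
    cong (λ P → inj₂ (¬ P)) (proposition-irrelevant x p p')
  op⁼-agree (eq _) (eq _) (x ∷ y ∷ []) (p ∷ q ∷ []) (p' ∷ q' ∷ []) =
    cong₂ (λ u v → inj₂ (u ≡ v)) (element-irrelevant x p p') (element-irrelevant y q q')

  mono⁼ : ∀ {s s' u} → _≤⁼_ S s s' → u ∈⁼ s → u ∈⁼ s'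
  mono⁼ {u = inj₁ _} (just≤ le) p = mono A le p
  mono⁼ {u = inj₂ _} nb≤ p = p

  A⁼ : Algebra (Sig⁼ S) (lsuc a) m
  A⁼ = record
    { U = U⁼ ; _∈_ = _∈⁼_ ; mono = λ {u = u} → mono⁼ {u = u} ; op = op⁼
    ; op-closed = op⁼-closed ; op-agree = op⁼-agree }

  module _ {Y : Vars S} (ρ⁼ : Assignment A⁼ (liftVars Y)) where

    restrict : Assignment A Y
    restrict = (λ y → element (proj₁ ρ⁼ y) (proj₂ ρ⁼ y))
             , (λ y → element-∈ (proj₁ ρ⁼ y) (proj₂ ρ⁼ y))

    mutual
      ⟦liftD⟧ : ∀ {t s} (d : HasSort S Y t s) →
                ⟦_⟧ A⁼ ρ⁼ (liftD d) ≡ inj₁ (⟦_⟧ A restrict d)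
      ⟦liftD⟧ (var {y} _) = inj₁-element (proj₁ ρ⁼ y) (proj₂ ρ⁼ y)
      ⟦liftD⟧ (app r ds _) = cong inj₁ (op-cong A r r _ _ (⟦liftDs⟧ ds))

      ⟦liftDs⟧ : ∀ {ts w} (ds : Pointwise (HasSort S Y) ts w) →
                 elements (proj₁ (evalDs A⁼ ρ⁼ (liftDs ds))) (proj₂ (evalDs A⁼ ρ⁼ (liftDs ds)))
                   ≡ proj₁ (evalDs A restrict ds)
      ⟦liftDs⟧ [] = refl
      ⟦liftDs⟧ (d ∷ ds) = cong₂ _∷_ (element-inj₁ _ _ (⟦liftD⟧ d)) (⟦liftDs⟧ ds)

    HoldsAt-liftAtom⁻ : (e : AtomicEq S Y) → HoldsAt A⁼ ρ⁼ (liftAtom e) → HoldsAt A restrict e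
    HoldsAt-liftAtom⁻ e h =
      inj₁-injective (trans (≡.sym (⟦liftD⟧ (ld e))) (trans h (⟦liftD⟧ (rd e))))

    HoldsAt-liftAtom : (e : AtomicEq S Y) → HoldsAt A restrict e → HoldsAt A⁼ ρ⁼ (liftAtom e)
    HoldsAt-liftAtom e h = trans (⟦liftD⟧ (ld e)) (trans (cong inj₁ h) (≡.sym (⟦liftD⟧ (rd e))))

    All-HoldsAt-liftAtom⁻ : (es : List (AtomicEq S Y)) →
                            All (HoldsAt A⁼ ρ⁼) (map liftAtom es) → All (HoldsAt A restrict) es
    All-HoldsAt-liftAtom⁻ [] [] = []
    All-HoldsAt-liftAtom⁻ (e ∷ es) (h ∷ hs) = HoldsAt-liftAtom⁻ e h ∷ All-HoldsAt-liftAtom⁻ es hs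

  A⁼-isModel : {I : Set} {E : I → Equation S} → IsModel A E → IsModel A⁼ (liftEq ∘ E)
  A⁼-isModel {E = E} model i ρ⁼ hs =
    HoldsAt-liftAtom ρ⁼ (concl (E i))
      (model i (restrict ρ⁼) (All-HoldsAt-liftAtom⁻ ρ⁼ (conds (E i)) hs))

  module _ {X : Vars S} (ρ : Assignment A X) where

    expand : Assignment A⁼ (liftVars X)
    expand = (inj₁ ∘ proj₁ ρ) , proj₂ ρ

    ⟦⌜⌝⟧ : (φ : Formula S X) → ⟦_⟧ A⁼ expand (⌜⌝-sorted φ) ≡ inj₂ (Sat A ρ φ)
    ⟦⌜⌝⟧ (atom e) = cong₂ (λ u v → inj₂ (u ≡ v))
      (element-inj₁ _ _ (⟦liftD⟧ expand (ld e))) (element-inj₁ _ _ (⟦liftD⟧ expand (rd e)))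
    ⟦⌜⌝⟧ ⊤f = refl
    ⟦⌜⌝⟧ ⊥f = refl
    ⟦⌜⌝⟧ (φ ∧f ψ) = cong₂ (λ P Q → inj₂ (P × Q))
      (proposition-inj₂ _ _ (⟦⌜⌝⟧ φ)) (proposition-inj₂ _ _ (⟦⌜⌝⟧ ψ))
    ⟦⌜⌝⟧ (φ ∨f ψ) = cong₂ (λ P Q → inj₂ (P ⊎ Q))
      (proposition-inj₂ _ _ (⟦⌜⌝⟧ φ)) (proposition-inj₂ _ _ (⟦⌜⌝⟧ ψ))
    ⟦⌜⌝⟧ (¬f φ) = cong (λ P → inj₂ (¬ P)) (proposition-inj₂ _ _ (⟦⌜⌝⟧ φ))

lemma1 : ∀ {a m : Level} (S : Signature) {I : Set} (E : I → Equation S)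
           (X : Vars S) (φ ψ : Formula S X) →
           Provable (Sig⁼ S) (λ i → liftEq (E i)) (liftVars X) ⌜ φ ⌝ ⌜ ψ ⌝ →
           (A : Algebra S a m) → IsModel A E →
           (ρ : Assignment A X) → Sat A ρ φ ⇔ Sat A ρ ψ
lemma1 S E X φ ψ φ=ψ A model ρ = ≡⇒ {k = equivalence} (inj₂-injective (begin
  inj₂ (Sat A ρ φ)          ≡⟨ ⟦⌜⌝⟧ ρ φ ⟨
  ⟦_⟧ A⁼ ρ⁼ (⌜⌝-sorted φ)  ≡⟨ sound A⁼-model ρ⁼ φ=ψ (⌜⌝-sorted φ) (⌜⌝-sorted ψ) ⟩
  ⟦_⟧ A⁼ ρ⁼ (⌜⌝-sorted ψ)  ≡⟨ ⟦⌜⌝⟧ ρ ψ ⟩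
  inj₂ (Sat A ρ ψ)          ∎))
  where open PropositionalExpansion A
        open ≡-Reasoning
        ρ⁼ : Assignment A⁼ (liftVars X)
        ρ⁼ = expand ρ
        A⁼-model : IsModel A⁼ (λ i → liftEq (E i))
        A⁼-model = A⁼-isModel {E = E} model
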